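{- Let $G$ be a finite graph with $\alpha(G)=2$ and let $\mathfrak A$ be a partition of $V(G)$ into exactly $\chi(G)$ independent sets. Let $\mathfrak A_1=\{A\in\mathfrak A:|A|=1\}$ and $\mathfrak A_2=\mathfrak A\setminus\mathfrak A_1$. Suppose that for every $A\in\mathfrak A_2$ there is some $\{v_A\}\in\mathfrak A_1$ with $|E(v_A,A)|=1$. Then $G$ admits an $\mathfrak A$-faithful $K_{\chi(G)}$-immersion.
   Context: $E(v,A)$ is the set of edges from $v$ to $A$. A (weak) $K_t$-immersion in $G$ consists of a corner set $\mathcal K\subseteq V(G)$ with $|\mathcal K|=t$ together with a family of pairwise edge-disjoint paths in $G$, one joining each unordered pair of distinct corners (internal vertices may be corners). For a partition $\mathfrak A$ of $V(G)$ into independent sets, a $K_t$-immersion is $\mathfrak A$-faithful if $|A\cap\mathcal K|\le1$ for every $A\in\mathfrak A$ and, for any two corners $u\in A\in\mathfrak A$ and $v\in B\in\mathfrak A$, all edges of the chosen $u$–$v$ path lie in the induced subgraph $G[A\cup B]$. -}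

module Defs where

open import Data.Nat using (ℕ; _≤_)
open import Data.Fin using (Fin; _≟_)
import Data.Fin as F
open import Data.Fin.Subset using (Subset; _∈_; ∣_∣)
open import Data.Vec using (tabulate; lookup)
open import Data.Bool using (Bool; true; false; _∧_)
open import Data.List using (List; _∷_; []; head; last)
open import Data.List.Relation.Unary.Linked using (Linked)
open import Data.List.Relation.Unary.Unique.Propositional using (Unique)
open import Data.Maybe using (just)
open import Data.Product using (Σ; ∃; _×_)
open import Data.Sum using (_⊎_)
open import Relation.Nullary using (¬_; ⌊_⌋)
open import Relation.Binary.PropositionalEquality using (_≡_; _≢_)

record Graph (n : ℕ) : Set where
  field
    adj    : Fin n → Fin n → Bool
    sym    : ∀ u v → adj u v ≡ adj v u
    irrefl : ∀ v → adj v v ≡ false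
open Graph public

module _ {n : ℕ} (G : Graph n) where

  Independent : Subset n → Set
  Independent S = ∀ u v → u ∈ S → v ∈ S → adj G u v ≡ false

  IsIndependenceNumber : ℕ → Set
  IsIndependenceNumber a =
    (Σ (Subset n) λ S → Independent S × ∣ S ∣ ≡ a)
    × (∀ S → Independent S → ∣ S ∣ ≤ a)

  ProperColouring : {k : ℕ} → (Fin n → Fin k) → Set
  ProperColouring c = ∀ u v → adj G u v ≡ true → c u ≢ c v

  IsChromaticNumber : ℕ → Set
  IsChromaticNumber k =
    (Σ (Fin n → Fin k) ProperColouring)
    × (∀ m (c : Fin n → Fin m) → ProperColouring c → k ≤ m)

Part : {n k : ℕ} → (Fin n → Fin k) → Fin k → Subset n
Part c i = tabulate (λ v → ⌊ c v ≟ i ⌋)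

module _ {n : ℕ} (G : Graph n) where

  -- c describes a partition of V(G) into exactly k (nonempty) independent sets
  IsIndependentPartition : {k : ℕ} → (Fin n → Fin k) → Set
  IsIndependentPartition {k} c =
    (∀ i → ∃ λ v → c v ≡ i) × (∀ i → Independent G (Part c i))

  -- the set of neighbours of v in S; its size is |E(v,S)| (simple graph)
  NbrsIn : Fin n → Subset n → Subset n
  NbrsIn v S = tabulate (λ w → adj G v w ∧ lookup S w)

data Consec {n : ℕ} (a b : Fin n) : List (Fin n) → Set where
  here  : ∀ {xs} → Consec a b (a ∷ b ∷ xs)
  there : ∀ {x xs} → Consec a b xs → Consec a b (x ∷ xs)

EdgeIn : {n : ℕ} → Fin n → Fin n → List (Fin n) → Set
EdgeIn a b p = Consec a b p ⊎ Consec b a p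

module _ {n : ℕ} (G : Graph n) where

  IsPath : Fin n → Fin n → List (Fin n) → Set
  IsPath x y p =
    head p ≡ just x × last p ≡ just y
    × Linked (λ a b → adj G a b ≡ true) p × Unique p

  record FaithfulImmersion {k : ℕ} (c : Fin n → Fin k) (t : ℕ) : Set where
    field
      corner       : Fin t → Fin n
      distinctPart : ∀ i j → c (corner i) ≡ c (corner j) → i ≡ j
      -- one path per unordered pair {i,j}, indexed by i < j
      path         : (i j : Fin t) → i F.< j → List (Fin n)
      isPath       : ∀ i j (h : i F.< j) → IsPath (corner i) (corner j) (path i j h)
      edgeDisjoint : ∀ i j (h : i F.< j) i' j' (h' : i' F.< j') → ¬ (i ≡ i' × j ≡ j') →
                     ∀ a b → EdgeIn a b (path i j h) → ¬ EdgeIn a b (path i' j' h')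
      faithful     : ∀ i j (h : i F.< j) a b → EdgeIn a b (path i j h) →
                     (c a ≡ c (corner i) ⊎ c a ≡ c (corner j))
                     × (c b ≡ c (corner i) ⊎ c b ≡ c (corner j))

{-# OPTIONS --safe #-}
-- Since α(G) = 2, every class has one or two vertices. The corner of a singleton class is its
-- vertex; the corner of a class A = {x, x'} is the neighbour x of v_A. The corners x ∈ A and
-- y ∈ B are joined by the edge xy if it exists and otherwise by the path x y' x' y (where x' = x,
-- y' = y for singleton classes). These paths stay inside G[A ∪ B], whose edges all join A to B,
-- so they are faithful and pairwise edge-disjoint. The path edges exist by an exchange argument:
-- moving x' into the class {v_A} keeps the colouring proper and leaves {x} as a class, and two
-- nonadjacent singleton classes could be merged, contradicting the minimality of χ(G). This makes
-- xy an edge when A or B is a singleton and y'x' an edge otherwise; xy' and x'y are edges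
-- because α(G) = 2.
module Submission where

open import Defs renaming (sym to adj-sym)
open import Data.Nat as ℕ using (ℕ; zero; suc; _≤_; _<_; s≤s)
open import Data.Nat.Properties using (≤-trans; n≮n; 1+n≢0)
open import Data.Fin as Fin using (Fin; _≟_; punchOut)
open import Data.Fin.Properties using (any?; punchOut-injective; <-asym; <⇒≢)
open import Data.Fin.Subset using (Subset; _∈_; ∣_∣; ⁅_⁆; _∪_; Nonempty)
open import Data.Fin.Subset.Properties
open import Data.Vec using (tabulate)
open import Data.Vec.Properties using (lookup∘tabulate; []=⇒lookup; lookup⇒[]=)
open import Data.Vec.Functional using (updateAt)
open import Data.Vec.Functional.Properties using (updateAt-updates; updateAt-minimal)
open import Data.Bool using (Bool; true; false; _∧_)
open import Data.Bool.Properties using (¬-not; not-¬; ∧-conicalˡ; ∧-conicalʳ; T-≡)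
open import Data.List using (List; _∷_; []; [_])
open import Data.List.Membership.Propositional renaming (_∈_ to _∈ₗ_)
open import Data.List.Relation.Unary.Any using (here; there)
open import Data.List.Relation.Unary.All as All using (All; _∷_; [])
open import Data.List.Relation.Unary.AllPairs using (_∷_; [])
open import Data.List.Relation.Unary.Linked using (Linked; [-]; _∷_)
open import Data.Product using (∃; _×_; _,_)
open import Data.Sum as Sum using (_⊎_; inj₁; inj₂)
open import Data.Empty using (⊥; ⊥-elim)
open import Function using (_∘_; const; Equivalence)
open import Relation.Nullary using (¬_; yes; no; ¬?; _×-dec_; contradiction)
open import Relation.Nullary.Decidable using (decidable-stable; toWitness; fromWitness)
open import Relation.Binary.PropositionalEquality using (_≡_; _≢_; refl; sym; trans; cong; cong₂; subst)

module _ {n : ℕ} where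

  x∈p⇒0<∣p∣ : ∀ {p : Subset n} {x} → x ∈ p → 0 < ∣ p ∣
  x∈p⇒0<∣p∣ {p} {x} x∈p = subst (_≤ ∣ p ∣) (∣⁅x⁆∣≡1 x)
    (p⊆q⇒∣p∣≤∣q∣ λ y∈⁅x⁆ → subst (_∈ p) (sym (x∈⁅y⁆⇒x≡y x y∈⁅x⁆)) x∈p)

  x∈p∧y∈p∧x≢y⇒1<∣p∣ : ∀ {p : Subset n} {x y} → x ∈ p → y ∈ p → x ≢ y → 1 < ∣ p ∣
  x∈p∧y∈p∧x≢y⇒1<∣p∣ x∈p y∈p x≢y =
    ≤-trans (s≤s (x∈p⇒0<∣p∣ (x∈p∧x≢y⇒x∈p-y y∈p (x≢y ∘ sym)))) (x∈p⇒∣p-x∣<∣p∣ x∈p)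

  x∈p∧y∈p∧z∈p∧distinct⇒2<∣p∣ : ∀ {p : Subset n} {x y z} → x ∈ p → y ∈ p → z ∈ p →
                               x ≢ y → x ≢ z → y ≢ z → 2 < ∣ p ∣
  x∈p∧y∈p∧z∈p∧distinct⇒2<∣p∣ x∈p y∈p z∈p x≢y x≢z y≢z =
    ≤-trans (s≤s (x∈p∧y∈p∧x≢y⇒1<∣p∣ (x∈p∧x≢y⇒x∈p-y y∈p (x≢y ∘ sym))
                                     (x∈p∧x≢y⇒x∈p-y z∈p (x≢z ∘ sym)) y≢z))
            (x∈p⇒∣p-x∣<∣p∣ x∈p)

  ∣p∣≡1⇒x≡y : ∀ {p : Subset n} → ∣ p ∣ ≡ 1 → ∀ {x y} → x ∈ p → y ∈ p → x ≡ y
  ∣p∣≡1⇒x≡y ∣p∣≡1 {x} {y} x∈p y∈p = decidable-stable (x ≟ y) λ x≢y →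
    n≮n 1 (subst (1 <_) ∣p∣≡1 (x∈p∧y∈p∧x≢y⇒1<∣p∣ x∈p y∈p x≢y))

  ∣p∣≢0⇒Nonempty : ∀ {p : Subset n} → ∣ p ∣ ≢ 0 → Nonempty p
  ∣p∣≢0⇒Nonempty {p} ∣p∣≢0 with nonempty? p
  ... | yes ne = ne
  ... | no ¬ne = contradiction (trans (cong ∣_∣ (Empty-unique ¬ne)) (∣⊥∣≡0 n)) ∣p∣≢0

  x∈p∧∣p∣≢1⇒∃y≢x : ∀ {p : Subset n} {x} → x ∈ p → ∣ p ∣ ≢ 1 → ∃ λ y → y ∈ p × y ≢ x
  x∈p∧∣p∣≢1⇒∃y≢x {p} {x} x∈p ∣p∣≢1 with any? (λ y → y ∈? p ×-dec ¬? (y ≟ x))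
  ... | yes found = found
  ... | no none = contradiction (trans (cong ∣_∣ p≡⁅x⁆) (∣⁅x⁆∣≡1 x)) ∣p∣≢1
    where
      p≡⁅x⁆ : p ≡ ⁅ x ⁆
      p≡⁅x⁆ = ⊆-antisym
        (λ {y} y∈p → subst (_∈ ⁅ x ⁆)
          (sym (decidable-stable (y ≟ x) λ y≢x → none (y , y∈p , y≢x))) (x∈⁅x⁆ x))
        (λ y∈⁅x⁆ → subst (_∈ p) (sym (x∈⁅y⁆⇒x≡y x y∈⁅x⁆)) x∈p)

module _ {n : ℕ} (f : Fin n → Bool) {x : Fin n} where

  ∈-tabulate⁺ : f x ≡ true → x ∈ tabulate f
  ∈-tabulate⁺ fx = lookup⇒[]= x (tabulate f) (trans (lookup∘tabulate f x) fx)

  ∈-tabulate⁻ : x ∈ tabulate f → f x ≡ true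
  ∈-tabulate⁻ x∈ = trans (sym (lookup∘tabulate f x)) ([]=⇒lookup x∈)

module _ {n k : ℕ} {c : Fin n → Fin k} {i : Fin k} {u : Fin n} where

  ∈-Part⁺ : c u ≡ i → u ∈ Part c i
  ∈-Part⁺ cu≡i = ∈-tabulate⁺ _ (Equivalence.to T-≡ (fromWitness cu≡i))

  ∈-Part⁻ : u ∈ Part c i → c u ≡ i
  ∈-Part⁻ u∈ = toWitness (Equivalence.from T-≡ (∈-tabulate⁻ _ u∈))

module _ {n : ℕ} (G : Graph n) {v u : Fin n} {S : Subset n} where

  ∈-NbrsIn⁺ : adj G v u ≡ true → u ∈ S → u ∈ NbrsIn G v S
  ∈-NbrsIn⁺ v~u u∈S = ∈-tabulate⁺ _ (cong₂ _∧_ v~u ([]=⇒lookup u∈S))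

  ∈-NbrsIn⁻ : u ∈ NbrsIn G v S → adj G v u ≡ true × u ∈ S
  ∈-NbrsIn⁻ u∈ = let v~u∧u∈S = ∈-tabulate⁻ _ u∈ in
    ∧-conicalˡ _ _ v~u∧u∈S , lookup⇒[]= u S (∧-conicalʳ _ _ v~u∧u∈S)

module _ {n k : ℕ} where

  ClassWithin : (Fin n → Fin k) → Fin k → List (Fin n) → Set
  ClassWithin c i xs = ∀ u → c u ≡ i → u ∈ₗ xs

  recolour : (Fin n → Fin k) → Fin n → Fin k → Fin n → Fin k
  recolour c x t = updateAt c x (const t)

  recolour-≡ : ∀ c x t u {j} → recolour c x t u ≡ j → (u ≡ x × t ≡ j) ⊎ (u ≢ x × c u ≡ j)
  recolour-≡ c x t u e with u ≟ x
  ... | yes refl = inj₁ (refl , trans (sym (updateAt-updates x c)) e)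
  ... | no u≢x   = inj₂ (u≢x , trans (sym (updateAt-minimal u x c u≢x)) e)

  module _ {c : Fin n → Fin k} {x : Fin n} {t j : Fin k} {xs : List (Fin n)} where

    recolour-ClassWithin : j ≢ t → ClassWithin c j xs → ClassWithin (recolour c x t) j xs
    recolour-ClassWithin j≢t cls u e with recolour-≡ c x t u e
    ... | inj₁ (_ , t≡j)  = contradiction (sym t≡j) j≢t
    ... | inj₂ (_ , cu≡j) = cls u cu≡j

    recolour-ClassWithin-∷ : ClassWithin c j xs → ClassWithin (recolour c x t) j (x ∷ xs)
    recolour-ClassWithin-∷ cls u e with recolour-≡ c x t u e
    ... | inj₁ (u≡x , _)  = here u≡x
    ... | inj₂ (_ , cu≡j) = there (cls u cu≡j)

  recolour-ClassWithin-drop : ∀ {c x x' t i} → t ≢ i → ClassWithin c i (x ∷ x' ∷ []) →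
                              ClassWithin (recolour c x' t) i [ x ]
  recolour-ClassWithin-drop {c} {x} {x'} {t} t≢i cls u e with recolour-≡ c x' t u e
  ... | inj₁ (_ , t≡i) = contradiction t≡i t≢i
  ... | inj₂ (u≢x' , cu≡i) with cls u cu≡i
  ...   | here u≡x          = here u≡x
  ...   | there (here u≡x') = contradiction u≡x' u≢x'

route : ∀ {A : Set} → Bool → A → A → A → A → List A
route true  x y x' y' = x ∷ y ∷ []
route false x y x' y' = x ∷ y' ∷ x' ∷ y ∷ []

route-All : ∀ {A : Set} {P : A → Set} b {x y x' y'} → P x → P y → P x' → P y' →
            All P (route b x y x' y')
route-All true  px py px' py' = px ∷ py ∷ []
route-All false px py px' py' = px ∷ py' ∷ px' ∷ py ∷ []

module _ {n : ℕ} where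

  Consec⇒∈ : ∀ {a b : Fin n} {p} → Consec a b p → a ∈ₗ p × b ∈ₗ p
  Consec⇒∈ here      = here refl , there (here refl)
  Consec⇒∈ (there q) = let (a∈ , b∈) = Consec⇒∈ q in there a∈ , there b∈

  EdgeIn⇒∈ : ∀ {a b : Fin n} {p} → EdgeIn a b p → a ∈ₗ p × b ∈ₗ p
  EdgeIn⇒∈ (inj₁ q) = Consec⇒∈ q
  EdgeIn⇒∈ (inj₂ q) = let (b∈ , a∈) = Consec⇒∈ q in a∈ , b∈

  Consec⇒R : ∀ {R : Fin n → Fin n → Set} {a b p} → Consec a b p → Linked R p → R a b
  Consec⇒R here      (r ∷ _)  = r
  Consec⇒R (there q) (_ ∷ rs) = Consec⇒R q rs

endpoints : ∀ {A : Set} {a b i j : A} → a ≢ b → (a ≡ i ⊎ a ≡ j) → (b ≡ i ⊎ b ≡ j) →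
            (a ≡ i × b ≡ j) ⊎ (a ≡ j × b ≡ i)
endpoints a≢b (inj₁ a≡i) (inj₂ b≡j) = inj₁ (a≡i , b≡j)
endpoints a≢b (inj₂ a≡j) (inj₁ b≡i) = inj₂ (a≡j , b≡i)
endpoints a≢b (inj₁ refl) (inj₁ refl) = contradiction refl a≢b
endpoints a≢b (inj₂ refl) (inj₂ refl) = contradiction refl a≢b

<-pair-unique : ∀ {k} {i j i' j' a b : Fin k} → i Fin.< j → i' Fin.< j' → a ≢ b →
                (a ≡ i ⊎ a ≡ j) → (b ≡ i ⊎ b ≡ j) → (a ≡ i' ⊎ a ≡ j') → (b ≡ i' ⊎ b ≡ j') →
                i ≡ i' × j ≡ j'
<-pair-unique i<j i'<j' a≢b a∈ b∈ a∈' b∈' with endpoints a≢b a∈ b∈ | endpoints a≢b a∈' b∈'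
... | inj₁ (refl , refl) | inj₁ (refl , refl) = refl , refl
... | inj₂ (refl , refl) | inj₂ (refl , refl) = refl , refl
... | inj₁ (refl , refl) | inj₂ (refl , refl) = contradiction i<j (<-asym i'<j')
... | inj₂ (refl , refl) | inj₁ (refl , refl) = contradiction i<j (<-asym i'<j')

module _ {n : ℕ} (G : Graph n) where

  adjacent⇒≢ : ∀ {u w} → adj G u w ≡ true → u ≢ w
  adjacent⇒≢ {u} u~w refl = not-¬ u~w (irrefl G u)

  nonadjacent-sym : ∀ {u w} → adj G u w ≡ false → adj G w u ≡ false
  nonadjacent-sym {u} {w} u≁w = trans (adj-sym G w u) u≁w

  edge-IsPath : ∀ {x y} → adj G x y ≡ true → IsPath G x y (x ∷ y ∷ [])
  edge-IsPath x~y = refl , refl , x~y ∷ [-] , (adjacent⇒≢ x~y ∷ []) ∷ [] ∷ []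

  detour-IsPath : ∀ {x y x' y'} → x ≢ y → adj G x y ≡ false →
                  adj G x y' ≡ true → adj G y' x' ≡ true → adj G x' y ≡ true →
                  IsPath G x y (x ∷ y' ∷ x' ∷ y ∷ [])
  detour-IsPath {x} {y} {x'} {y'} x≢y x≁y x~y' y'~x' x'~y =
    refl , refl , x~y' ∷ y'~x' ∷ x'~y ∷ [-] ,
    (adjacent⇒≢ x~y' ∷ x≢x' ∷ x≢y ∷ []) ∷ (adjacent⇒≢ y'~x' ∷ y'≢y ∷ []) ∷
    (adjacent⇒≢ x'~y ∷ []) ∷ [] ∷ []
    where
      x≢x' : x ≢ x'
      x≢x' refl = not-¬ x'~y x≁y
      y'≢y : y' ≢ y
      y'≢y refl = not-¬ x~y' x≁y

  IsPath⇒adjacent : ∀ {x y p a b} → IsPath G x y p → EdgeIn a b p → adj G a b ≡ true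
  IsPath⇒adjacent (_ , _ , linked , _) (inj₁ q) = Consec⇒R q linked
  IsPath⇒adjacent {a = a} {b} (_ , _ , linked , _) (inj₂ q) = trans (adj-sym G a b) (Consec⇒R q linked)

  module _ (α≤2 : ∀ S → Independent G S → ∣ S ∣ ≤ 2) where

    no-independent-triple : ∀ {a b d} → a ≢ b → a ≢ d → b ≢ d →
                            adj G a b ≡ false → adj G a d ≡ false → adj G b d ≡ false → ⊥
    no-independent-triple {a} {b} {d} a≢b a≢d b≢d a≁b a≁d b≁d =
      n≮n 2 (≤-trans (x∈p∧y∈p∧z∈p∧distinct⇒2<∣p∣ a∈S b∈S d∈S a≢b a≢d b≢d) (α≤2 S independent))
      where
        S : Subset n
        S = ⁅ a ⁆ ∪ ⁅ b ⁆ ∪ ⁅ d ⁆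
        a∈S : a ∈ S
        a∈S = x∈p∪q⁺ (inj₁ (x∈⁅x⁆ a))
        b∈S : b ∈ S
        b∈S = x∈p∪q⁺ (inj₂ (x∈p∪q⁺ (inj₁ (x∈⁅x⁆ b))))
        d∈S : d ∈ S
        d∈S = x∈p∪q⁺ (inj₂ (x∈p∪q⁺ (inj₂ (x∈⁅x⁆ d))))
        ∈S⁻ : ∀ {u} → u ∈ S → u ∈ₗ a ∷ b ∷ d ∷ []
        ∈S⁻ u∈S with x∈p∪q⁻ _ _ u∈S
        ... | inj₁ u∈a = here (x∈⁅y⁆⇒x≡y a u∈a)
        ... | inj₂ u∈bd with x∈p∪q⁻ _ _ u∈bd
        ...   | inj₁ u∈b = there (here (x∈⁅y⁆⇒x≡y b u∈b))
        ...   | inj₂ u∈d = there (there (here (x∈⁅y⁆⇒x≡y d u∈d)))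
        nonadjacent : ∀ {u w} → u ∈ₗ a ∷ b ∷ d ∷ [] → w ∈ₗ a ∷ b ∷ d ∷ [] → adj G u w ≡ false
        nonadjacent (here refl)                 (here refl)                 = irrefl G a
        nonadjacent (here refl)                 (there (here refl))         = a≁b
        nonadjacent (here refl)                 (there (there (here refl))) = a≁d
        nonadjacent (there (here refl))         (here refl)                 = nonadjacent-sym a≁b
        nonadjacent (there (here refl))         (there (here refl))         = irrefl G b
        nonadjacent (there (here refl))         (there (there (here refl))) = b≁d
        nonadjacent (there (there (here refl))) (here refl)                 = nonadjacent-sym a≁d
        nonadjacent (there (there (here refl))) (there (here refl))         = nonadjacent-sym b≁d
        nonadjacent (there (there (here refl))) (there (there (here refl))) = irrefl G d
        independent : Independent G S
        independent u w u∈S w∈S = nonadjacent (∈S⁻ u∈S) (∈S⁻ w∈S)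

  every-colour-used : ∀ {k} → IsChromaticNumber G k → ∀ {c : Fin n → Fin k} → ProperColouring G c →
                      ∀ j → ¬ (∀ u → c u ≢ j)
  every-colour-used {zero} _ _ ()
  every-colour-used {suc k} (_ , minimal) {c} proper j unused = n≮n k (minimal k c' proper')
    where
      c' : Fin n → Fin k
      c' u = punchOut (unused u ∘ sym)
      proper' : ProperColouring G c'
      proper' u w u~w c'u≡c'w =
        proper u w u~w (punchOut-injective (unused u ∘ sym) (unused w ∘ sym) c'u≡c'w)

  module _ {k : ℕ} where

    recolour-proper : ∀ {c : Fin n → Fin k} {x t xs} → ProperColouring G c → ClassWithin c t xs →
                      All (λ u → adj G x u ≡ false) xs → ProperColouring G (recolour c x t)
    recolour-proper {c} {x} {t} proper cls x≁xs u w u~w same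
      with recolour-≡ c x t u same | recolour-≡ c x t w refl
    ... | inj₁ (refl , _)   | inj₁ (refl , _)  = not-¬ u~w (irrefl G u)
    ... | inj₁ (refl , t≡l) | inj₂ (_ , cw≡l)  =
      not-¬ u~w (All.lookup x≁xs (cls w (trans cw≡l (sym t≡l))))
    ... | inj₂ (_ , cu≡l)   | inj₁ (refl , t≡l) =
      not-¬ u~w (nonadjacent-sym (All.lookup x≁xs (cls u (trans cu≡l (sym t≡l)))))
    ... | inj₂ (_ , cu≡l)   | inj₂ (_ , cw≡l)  = proper u w u~w (trans cu≡l (sym cw≡l))

    -- Moving x into the class {y} empties the class {x}, leaving k - 1 colours.
    singleton-classes-adjacent : IsChromaticNumber G k → ∀ {c : Fin n → Fin k} {i j x y} →
                                 ProperColouring G c → i ≢ j →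
                                 ClassWithin c i [ x ] → ClassWithin c j [ y ] → adj G x y ≡ true
    singleton-classes-adjacent χ {c} {i} {j} {x} proper i≢j cls-i cls-j =
      ¬-not λ x≁y → every-colour-used χ (recolour-proper proper cls-j (x≁y ∷ [])) i i-unused
      where
        i-unused : ∀ u → recolour c x j u ≢ i
        i-unused u e with recolour-≡ c x j u e
        ... | inj₁ (_ , j≡i) = i≢j (sym j≡i)
        ... | inj₂ (u≢x , cu≡i) with cls-i u cu≡i
        ...   | here u≡x = u≢x u≡x

module Construction {n : ℕ} (G : Graph n) (α≤2 : ∀ S → Independent G S → ∣ S ∣ ≤ 2)
                    {k : ℕ} (χ : IsChromaticNumber G k) (c : Fin n → Fin k)
                    (independent : ∀ i → Independent G (Part c i)) where

  same-colour⇒nonadjacent : ∀ {u w} → c u ≡ c w → adj G u w ≡ false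
  same-colour⇒nonadjacent cu≡cw = independent _ _ _ (∈-Part⁺ cu≡cw) (∈-Part⁺ refl)

  proper : ProperColouring G c
  proper u w u~w cu≡cw = not-¬ u~w (same-colour⇒nonadjacent cu≡cw)

  class-⊆-pair : ∀ {i x x'} → c x ≡ i → c x' ≡ i → x ≢ x' → ClassWithin c i (x ∷ x' ∷ [])
  class-⊆-pair {x = x} {x'} cx cx' x≢x' u cu with u ≟ x | u ≟ x'
  ... | yes u≡x | _        = here u≡x
  ... | no _    | yes u≡x' = there (here u≡x')
  ... | no u≢x  | no u≢x'  = ⊥-elim (no-independent-triple G α≤2 u≢x u≢x' x≢x'
    (same-colour⇒nonadjacent (trans cu (sym cx))) (same-colour⇒nonadjacent (trans cu (sym cx')))
    (same-colour⇒nonadjacent (trans cx (sym cx'))))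

  record PairClass (i : Fin k) : Set where
    field
      x x' v    : Fin n
      x-colour  : c x ≡ i
      x'-colour : c x' ≡ i
      class     : ClassWithin c i (x ∷ x' ∷ [])
      v-class   : ClassWithin c (c v) [ v ]
      v~x       : adj G v x ≡ true
      v≁x'      : adj G v x' ≡ false

    x≢x' : x ≢ x'
    x≢x' x≡x' = not-¬ v~x (subst (λ z → adj G v z ≡ false) (sym x≡x') v≁x')

    v-colour≢i : c v ≢ i
    v-colour≢i cv≡i = proper v x v~x (trans cv≡i (sym x-colour))

    v-colour≢ : ∀ {j y} → c y ≡ j → adj G x y ≡ false → c v ≢ j
    v-colour≢ cy x≁y cv≡j with v-class _ (trans cy (sym cv≡j))
    ... | here refl = not-¬ v~x (nonadjacent-sym G x≁y)

    reduced : Fin n → Fin k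
    reduced = recolour c x' (c v)

    reduced-proper : ProperColouring G reduced
    reduced-proper = recolour-proper G proper v-class (nonadjacent-sym G v≁x' ∷ [])

    reduced-class : ClassWithin reduced i [ x ]
    reduced-class = recolour-ClassWithin-drop v-colour≢i class

  data ClassShape (i : Fin k) : Set where
    singleton : (x : Fin n) → c x ≡ i → ClassWithin c i [ x ] → ClassShape i
    pair      : PairClass i → ClassShape i

  module _ {i j : Fin k} (i≢j : i ≢ j) (P : PairClass i) where
    open PairClass P

    pair-singleton-adjacent : ∀ {y} → c y ≡ j → ClassWithin c j [ y ] → adj G x y ≡ true
    pair-singleton-adjacent cy cls-y = ¬-not λ x≁y → not-¬
      (singleton-classes-adjacent G χ reduced-proper i≢j reduced-class
        (recolour-ClassWithin (v-colour≢ cy x≁y ∘ sym) cls-y))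
      x≁y

    -- The middle edge: otherwise x' can join v's class and then y' can join w's class (even if
    -- w = v), leaving the nonadjacent singleton classes {x} and {y}.
    pair-pair-detour : (Q : PairClass j) → let module Q = PairClass Q in adj G x Q.x ≡ false →
                       adj G x Q.x' ≡ true × adj G Q.x' x' ≡ true × adj G x' Q.x ≡ true
    pair-pair-detour Q x≁y = x~y' , y'~x' , x'~y
      where
        open PairClass Q using () renaming (x to y; x' to y'; v to w; x-colour to y-colour;
          x'-colour to y'-colour; class to class-j; v-class to w-class; v≁x' to w≁y';
          x≢x' to y≢y'; v-colour≢i to w-colour≢j; v-colour≢ to w-colour≢)

        ≢-by-colour : ∀ {a b} → c a ≡ i → c b ≡ j → a ≢ b
        ≢-by-colour ca cb refl = i≢j (trans (sym ca) cb)

        x~y' : adj G x y' ≡ true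
        x~y' = ¬-not λ x≁y' → no-independent-triple G α≤2
          (≢-by-colour x-colour y-colour) (≢-by-colour x-colour y'-colour) y≢y'
          x≁y x≁y' (same-colour⇒nonadjacent (trans y-colour (sym y'-colour)))

        x'~y : adj G x' y ≡ true
        x'~y = ¬-not λ x'≁y → no-independent-triple G α≤2
          x≢x' (≢-by-colour x-colour y-colour) (≢-by-colour x'-colour y-colour)
          (same-colour⇒nonadjacent (trans x-colour (sym x'-colour))) x≁y x'≁y

        reduced₂ : Fin n → Fin k
        reduced₂ = recolour reduced y' (c w)

        reduced₂-proper : adj G y' x' ≡ false → ProperColouring G reduced₂
        reduced₂-proper y'≁x' = recolour-proper G reduced-proper (recolour-ClassWithin-∷ w-class)
          (y'≁x' ∷ nonadjacent-sym G w≁y' ∷ [])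

        reduced₂-class-i : ClassWithin reduced₂ i [ x ]
        reduced₂-class-i =
          recolour-ClassWithin (w-colour≢ x-colour (nonadjacent-sym G x≁y) ∘ sym) reduced-class

        reduced₂-class-j : ClassWithin reduced₂ j [ y ]
        reduced₂-class-j = recolour-ClassWithin-drop w-colour≢j
          (recolour-ClassWithin (v-colour≢ y-colour x≁y ∘ sym) class-j)

        y'~x' : adj G y' x' ≡ true
        y'~x' = ¬-not λ y'≁x' → not-¬ (singleton-classes-adjacent G χ (reduced₂-proper y'≁x') i≢j
          reduced₂-class-i reduced₂-class-j) x≁y

  pairClass : ∀ {i} → ∣ Part c i ∣ ≢ 1 →
              (∃ λ v → ∣ Part c (c v) ∣ ≡ 1 × ∣ NbrsIn G v (Part c i) ∣ ≡ 1) → PairClass i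
  pairClass {i} ∣i∣≢1 (v , ∣v∣≡1 , ∣N∣≡1)
    with x , x∈N ← ∣p∣≢0⇒Nonempty (1+n≢0 ∘ trans (sym ∣N∣≡1))
    with v~x , x∈i ← ∈-NbrsIn⁻ G x∈N
    with x' , x'∈i , x'≢x ← x∈p∧∣p∣≢1⇒∃y≢x x∈i ∣i∣≢1
    = record
      { x = x ; x' = x' ; v = v
      ; x-colour = ∈-Part⁻ x∈i
      ; x'-colour = ∈-Part⁻ x'∈i
      ; class = class-⊆-pair (∈-Part⁻ x∈i) (∈-Part⁻ x'∈i) (x'≢x ∘ sym)
      ; v-class = λ u cu≡cv → here (∣p∣≡1⇒x≡y ∣v∣≡1 (∈-Part⁺ cu≡cv) (∈-Part⁺ refl))
      ; v~x = v~x
      ; v≁x' = ¬-not λ v~x' → x'≢x (∣p∣≡1⇒x≡y ∣N∣≡1 (∈-NbrsIn⁺ G v~x' x'∈i) x∈N)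
      }

  classShape : (∀ i → ¬ (∣ Part c i ∣ ≡ 1) →
                 ∃ λ v → ∣ Part c (c v) ∣ ≡ 1 × ∣ NbrsIn G v (Part c i) ∣ ≡ 1) →
               ∀ i → ClassShape i
  classShape hyp i with ∣ Part c i ∣ ℕ.≟ 1
  ... | no ∣i∣≢1 = pair (pairClass ∣i∣≢1 (hyp i ∣i∣≢1))
  ... | yes ∣i∣≡1 with x , x∈i ← ∣p∣≢0⇒Nonempty (1+n≢0 ∘ trans (sym ∣i∣≡1)) =
    singleton x (∈-Part⁻ x∈i) (λ u cu≡i → here (∣p∣≡1⇒x≡y ∣i∣≡1 (∈-Part⁺ cu≡i) x∈i))

  module _ {i : Fin k} where

    corner other : ClassShape i → Fin n
    corner (singleton x _ _) = x
    corner (pair P)          = PairClass.x P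
    other (singleton x _ _)  = x
    other (pair P)           = PairClass.x' P

    corner-colour : (I : ClassShape i) → c (corner I) ≡ i
    corner-colour (singleton _ cx _) = cx
    corner-colour (pair P)           = PairClass.x-colour P

    other-colour : (I : ClassShape i) → c (other I) ≡ i
    other-colour (singleton _ cx _) = cx
    other-colour (pair P)           = PairClass.x'-colour P

  detour : ∀ {i j} → i ≢ j → (I : ClassShape i) (J : ClassShape j) →
           adj G (corner I) (corner J) ≡ false →
           adj G (corner I) (other J) ≡ true × adj G (other J) (other I) ≡ true ×
           adj G (other I) (corner J) ≡ true
  detour i≢j (singleton x _ cls-x) (singleton y _ cls-y) x≁y =
    ⊥-elim (not-¬ (singleton-classes-adjacent G χ proper i≢j cls-x cls-y) x≁y)
  detour i≢j (pair P) (singleton y cy cls-y) x≁y =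
    ⊥-elim (not-¬ (pair-singleton-adjacent i≢j P cy cls-y) x≁y)
  detour i≢j (singleton x cx cls-x) (pair Q) x≁y =
    ⊥-elim (not-¬ (pair-singleton-adjacent (i≢j ∘ sym) Q cx cls-x) (nonadjacent-sym G x≁y))
  detour i≢j (pair P) (pair Q) x≁y = pair-pair-detour i≢j P Q x≁y

  module Immersion (shape : ∀ i → ClassShape i) where

    corners others : Fin k → Fin n
    corners i = corner (shape i)
    others i  = other (shape i)

    corner-colours-distinct : ∀ i j → c (corners i) ≡ c (corners j) → i ≡ j
    corner-colours-distinct i j eq =
      trans (sym (corner-colour (shape i))) (trans eq (corner-colour (shape j)))

    path : (i j : Fin k) → i Fin.< j → List (Fin n)
    path i j _ = route (adj G (corners i) (corners j)) (corners i) (corners j) (others i) (others j)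

    path-IsPath : ∀ i j (i<j : i Fin.< j) → IsPath G (corners i) (corners j) (path i j i<j)
    path-IsPath i j i<j with adj G (corners i) (corners j) in e
    ... | true  = edge-IsPath G e
    ... | false = let x~y' , y'~x' , x'~y = detour (<⇒≢ i<j) (shape i) (shape j) e in
      detour-IsPath G (<⇒≢ i<j ∘ corner-colours-distinct i j ∘ cong c) e x~y' y'~x' x'~y

    path-colours : ∀ i j (i<j : i Fin.< j) → All (λ u → c u ≡ i ⊎ c u ≡ j) (path i j i<j)
    path-colours i j _ = route-All (adj G (corners i) (corners j))
      (inj₁ (corner-colour (shape i))) (inj₂ (corner-colour (shape j)))
      (inj₁ (other-colour (shape i))) (inj₂ (other-colour (shape j)))

    edge-colours : ∀ i j (i<j : i Fin.< j) {a b} → EdgeIn a b (path i j i<j) →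
                   (c a ≡ i ⊎ c a ≡ j) × (c b ≡ i ⊎ c b ≡ j)
    edge-colours i j i<j e = let a∈ , b∈ = EdgeIn⇒∈ e in
      All.lookup (path-colours i j i<j) a∈ , All.lookup (path-colours i j i<j) b∈

    immersion : FaithfulImmersion G c k
    immersion = record
      { corner       = corners
      ; distinctPart = corner-colours-distinct
      ; path         = path
      ; isPath       = path-IsPath
      ; edgeDisjoint = λ i j i<j i' j' i'<j' ≢pair a b e e' →
          let a∈ , b∈ = edge-colours i j i<j e ; a∈' , b∈' = edge-colours i' j' i'<j' e' in
          ≢pair (<-pair-unique i<j i'<j' (proper a b (IsPath⇒adjacent G (path-IsPath i j i<j) e))
                  a∈ b∈ a∈' b∈')
      ; faithful     = λ i j i<j a b e → let a∈ , b∈ = edge-colours i j i<j e in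
          to-corner i j a∈ , to-corner i j b∈
      }
      where
        to-corner : ∀ i j {u} → c u ≡ i ⊎ c u ≡ j →
                    c u ≡ c (corners i) ⊎ c u ≡ c (corners j)
        to-corner i j = Sum.map (λ cu≡i → trans cu≡i (sym (corner-colour (shape i))))
                                (λ cu≡j → trans cu≡j (sym (corner-colour (shape j))))

lemma3p5 : ∀ {n : ℕ} (G : Graph n) → IsIndependenceNumber G 2 →
           ∀ (k : ℕ) → IsChromaticNumber G k →
           (c : Fin n → Fin k) → IsIndependentPartition G c →
           (∀ i → ¬ (∣ Part c i ∣ ≡ 1) →
             ∃ λ v → ∣ Part c (c v) ∣ ≡ 1 × ∣ NbrsIn G v (Part c i) ∣ ≡ 1) →
           FaithfulImmersion G c k
-- The classes need not be assumed nonempty: hyp provides a vertex in every class of size ≠ 1.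
lemma3p5 G (_ , α≤2) k χ c (_ , independent) hyp =
  Immersion.immersion (classShape hyp)
  where open Construction G α≤2 χ c independent
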